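{- Let $G$ be a graph with minimum degree $\delta(G)\ge 2$. Then: (1) $G$ has a $\gamma$-set $D$ such that every vertex in $D$ has at least two neighbors in $V_G-D$; (2) $\gamma(G)=\gamma_{\rm cer}(G)$.
   Context: All graphs are finite and simple. A set $D\subseteq V_G$ is a dominating set of $G$ if every vertex of $V_G-D$ is adjacent to at least one vertex of $D$; $\gamma(G)$ is the minimum cardinality of a dominating set, and a $\gamma$-set is a dominating set of cardinality $\gamma(G)$. A set $D\subseteq V_G$ is a certified dominating set of $G$ if $D$ is a dominating set of $G$ and every vertex in $D$ has either zero or at least two neighbors in $V_G-D$; $\gamma_{\rm cer}(G)$ is the minimum cardinality of a certified dominating set of $G$. -}

module Defs where

open import Data.Nat using (ℕ; _≤_)
open import Data.Bool using (Bool; true; false; _∧_; not; T)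
open import Data.Fin using (Fin)
open import Data.Fin.Subset using (Subset; _∈_; _∉_; ∣_∣)
open import Data.Vec using (lookup)
open import Data.List using (List; filter; length)
open import Data.Product using (Σ; ∃; _×_; _,_)
open import Data.Sum using (_⊎_)
open import Relation.Binary.PropositionalEquality using (_≡_)
open import Relation.Nullary.Decidable using (does)
open import Data.Bool.Properties using (T?)
import Data.List as L

record Graph (n : ℕ) : Set where
  field
    adj    : Fin n → Fin n → Bool
    sym    : ∀ u v → adj u v ≡ adj v u
    irrefl : ∀ v → adj v v ≡ false
open Graph public

countV : {n : ℕ} → (Fin n → Bool) → ℕ
countV {n} p = length (filter (λ u → T? (p u)) (L.allFin n))

deg : {n : ℕ} → Graph n → Fin n → ℕ
deg G v = countV (λ u → adj G v u)

MinDegreeAtLeast : {n : ℕ} → Graph n → ℕ → Set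
MinDegreeAtLeast G k = ∀ v → k ≤ deg G v

Dominating : {n : ℕ} → Graph n → Subset n → Set
Dominating G D = ∀ v → v ∉ D → ∃ λ u → u ∈ D × T (adj G u v)

outNbrs : {n : ℕ} → Graph n → Subset n → Fin n → ℕ
outNbrs G D v = countV (λ u → adj G v u ∧ not (lookup D u))

Certified : {n : ℕ} → Graph n → Subset n → Set
Certified G D = Dominating G D ×
  (∀ v → v ∈ D → outNbrs G D v ≡ 0 ⊎ 2 ≤ outNbrs G D v)

IsGammaSet : {n : ℕ} → Graph n → Subset n → Set
IsGammaSet G D = Dominating G D × (∀ D' → Dominating G D' → ∣ D ∣ ≤ ∣ D' ∣)

IsGamma : {n : ℕ} → Graph n → ℕ → Set
IsGamma G k = (∃ λ D → Dominating G D × ∣ D ∣ ≡ k) × (∀ D → Dominating G D → k ≤ ∣ D ∣)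

IsGammaCer : {n : ℕ} → Graph n → ℕ → Set
IsGammaCer G k = (∃ λ D → Certified G D × ∣ D ∣ ≡ k) × (∀ D → Certified G D → k ≤ ∣ D ∣)

-- Among the γ-sets choose D with as few vertices as possible that have a neighbour in D.
-- Suppose v ∈ D has at most one neighbour outside D. As deg v ≥ 2, v has a neighbour w ∈ D.
-- If every outside neighbour of v has a neighbour in D other than v, then D - v still
-- dominates, contradicting |D| = γ. Otherwise v has an outside neighbour u whose only
-- neighbour in D is v; then D - v + u is again a γ-set, and in it fewer vertices have a
-- neighbour inside the set: v has left, and u has no neighbour in D - v. So this D is a
-- certified γ-set, whence γ_cer ≤ γ; γ ≤ γ_cer holds as certified sets dominate.
module Submission where

open import Defs hiding (sym)
open import Level using (Level)
open import Data.Nat using (ℕ; suc; _+_; _≤_; _<_; z≤n; s≤s; _≤?_)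
open import Data.Nat.Properties
  using (≤-refl; ≤-reflexive; ≤-trans; ≤-antisym; +-mono-≤; +-suc; <⇒≱; ≰⇒>; ≮⇒≥)
open import Data.Bool using (Bool; true; false; T; not; _∧_)
open import Data.Bool.Properties using (T?; T-∧; T-not-≡)
open import Data.Empty using (⊥)
open import Data.Fin using (Fin; _≟_)
open import Data.Fin.Properties using (any?; all?)
open import Data.Fin.Subset
  using (Subset; _∈_; _∉_; _⊆_; _⊂_; _∪_; _─_; _-_; ⁅_⁆; ∣_∣; ⊤; inside; outside)
open import Data.Fin.Subset.Properties
  using (_∈?_; ∈⊤; anySubset?; x∈⁅x⁆; x∈⁅y⁆⇒x≡y; x∈p∧x≢y⇒x∈p-y; p─q⊆p; x∈p∪q⁻; x∈p∪q⁺;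
         ∣⁅x⁆∣≡1; ∣p∣≤∣x∷p∣; x∈p⇒∣p-x∣<∣p∣; p⊂q⇒∣p∣<∣q∣)
open import Data.Vec using ([]; _∷_; there; lookup; tabulate)
open import Data.Vec.Properties using (lookup∘tabulate; lookup⇒[]=; []=⇒lookup)
open import Data.List using (List; []; _∷_; length; filter; allFin)
open import Data.List.Membership.Propositional using () renaming (_∈_ to _∈ₗ_)
open import Data.List.Membership.Propositional.Properties using (∈-filter⁺; ∈-filter⁻; ∈-allFin)
open import Data.List.Relation.Unary.Any using (here; there)
open import Data.List.Relation.Unary.All using (_∷_)
open import Data.List.Relation.Unary.AllPairs using (_∷_)
open import Data.List.Relation.Unary.Unique.Propositional using (Unique)
open import Data.List.Relation.Unary.Unique.Propositional.Properties using (allFin⁺; filter⁺)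
open import Data.Product using (∃; ∃₂; _×_; _,_; proj₁; proj₂)
open import Data.Sum using (_⊎_; inj₁; inj₂)
open import Function using (_∘_)
open import Function.Bundles using (Equivalence)
open import Relation.Nullary using (¬_; yes; no; does; contradiction)
open import Relation.Nullary.Decidable using (_×-dec_; _→-dec_; ¬?; dec-true)
open import Relation.Unary using (Pred; Decidable)
open import Relation.Binary.PropositionalEquality using (_≡_; _≢_; refl; sym; trans; subst; cong)

private
  variable
    ℓ : Level
    n : ℕ

module _ {A : Set} where

  two≤length : ∀ {x y} {xs : List A} → x ∈ₗ xs → y ∈ₗ xs → x ≢ y → 2 ≤ length xs
  two≤length (here refl) (here refl) x≢y = contradiction refl x≢y
  two≤length (here refl) (there {xs = _ ∷ _} _) _ = s≤s (s≤s z≤n)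
  two≤length (there {xs = _ ∷ _} _) _ _ = s≤s (s≤s z≤n)

  unique⇒distinct-pair : ∀ {xs : List A} → Unique xs → 2 ≤ length xs →
                         ∃₂ λ x y → x ∈ₗ xs × y ∈ₗ xs × x ≢ y
  unique⇒distinct-pair {x ∷ y ∷ _} ((x≢y ∷ _) ∷ _) _ = x , y , here refl , there (here refl) , x≢y
  unique⇒distinct-pair {_ ∷ []} _ (s≤s ())

module _ (p : Fin n → Bool) where

  witnesses : List (Fin n)
  witnesses = filter (λ u → T? (p u)) (allFin _)

  ∈-witnesses⁺ : ∀ {x} → T (p x) → x ∈ₗ witnesses
  ∈-witnesses⁺ {x} = ∈-filter⁺ (λ u → T? (p u)) (∈-allFin x)

  ∈-witnesses⁻ : ∀ {x} → x ∈ₗ witnesses → T (p x)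
  ∈-witnesses⁻ = proj₂ ∘ ∈-filter⁻ (λ u → T? (p u)) {xs = allFin _}

  countV<2⇒≡ : countV p < 2 → ∀ {x y} → T (p x) → T (p y) → x ≡ y
  countV<2⇒≡ countV<2 {x} {y} px py with x ≟ y
  ... | yes x≡y = x≡y
  ... | no x≢y = contradiction (two≤length (∈-witnesses⁺ px) (∈-witnesses⁺ py) x≢y) (<⇒≱ countV<2)

  2≤countV⇒distinct : 2 ≤ countV p → ∃₂ λ x y → T (p x) × T (p y) × x ≢ y
  2≤countV⇒distinct 2≤countV
    with x , y , x∈ , y∈ , x≢y ← unique⇒distinct-pair (filter⁺ (λ u → T? (p u)) {allFin _} (allFin⁺ _)) 2≤countV
    = x , y , ∈-witnesses⁻ x∈ , ∈-witnesses⁻ y∈ , x≢y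

x∈p─q⇒x∉q : ∀ (p q : Subset n) {x} → x ∈ p ─ q → x ∉ q
x∈p─q⇒x∉q (_ ∷ p) (_ ∷ q) (there x∈) (there x∈q) = x∈p─q⇒x∉q p q x∈ x∈q

x∈p-y⁻ : ∀ (p : Subset n) {x y} → x ∈ p - y → x ∈ p × x ≢ y
x∈p-y⁻ p {y = y} x∈ = p─q⊆p p ⁅ y ⁆ x∈ , λ { refl → x∈p─q⇒x∉q p ⁅ y ⁆ x∈ (x∈⁅x⁆ y) }

∣p∪q∣≤∣p∣+∣q∣ : ∀ (p q : Subset n) → ∣ p ∪ q ∣ ≤ ∣ p ∣ + ∣ q ∣
∣p∪q∣≤∣p∣+∣q∣ []            []            = z≤n
∣p∪q∣≤∣p∣+∣q∣ (outside ∷ p) (outside ∷ q) = ∣p∪q∣≤∣p∣+∣q∣ p q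
∣p∪q∣≤∣p∣+∣q∣ (outside ∷ p) (inside ∷ q)  =
  ≤-trans (s≤s (∣p∪q∣≤∣p∣+∣q∣ p q)) (≤-reflexive (sym (+-suc ∣ p ∣ ∣ q ∣)))
∣p∪q∣≤∣p∣+∣q∣ (inside ∷ p)  (s ∷ q)       = s≤s (≤-trans (∣p∪q∣≤∣p∣+∣q∣ p q) (+-mono-≤ ≤-refl (∣p∣≤∣x∷p∣ s q)))

∣⁅u⁆∪p-v∣≤∣p∣ : ∀ {p : Subset n} {v} u → v ∈ p → ∣ ⁅ u ⁆ ∪ (p - v) ∣ ≤ ∣ p ∣
∣⁅u⁆∪p-v∣≤∣p∣ {p = p} {v} u v∈p =
  ≤-trans (∣p∪q∣≤∣p∣+∣q∣ ⁅ u ⁆ (p - v))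
          (subst (λ k → k + ∣ p - v ∣ ≤ ∣ p ∣) (sym (∣⁅x⁆∣≡1 u)) (x∈p⇒∣p-x∣<∣p∣ v∈p))

p-v⊆q∧x∉q∧x≢v⇒x∉p : ∀ {p q : Subset n} {v x} → p - v ⊆ q → x ∉ q → x ≢ v → x ∉ p
p-v⊆q∧x∉q∧x≢v⇒x∉p p-v⊆q x∉q x≢v x∈p = x∉q (p-v⊆q (x∈p∧x≢y⇒x∈p-y x∈p x≢v))

lookup-∉ : ∀ {p : Subset n} {x} → x ∉ p → lookup p x ≡ false
lookup-∉ {p = p} {x} x∉p with lookup p x in eq
... | true  = contradiction (lookup⇒[]= x p eq) x∉p
... | false = refl

module _ {P : Pred (Fin n) ℓ} (P? : Decidable P) where

  select : Subset n
  select = tabulate (does ∘ P?)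

  ∈-select⁺ : ∀ {x} → P x → x ∈ select
  ∈-select⁺ {x} px = lookup⇒[]= x select (trans (lookup∘tabulate (does ∘ P?) x) (dec-true (P? x) px))

  ∈-select⁻ : ∀ {x} → x ∈ select → P x
  ∈-select⁻ {x} x∈ with P? x in eq
  ... | yes px = px
  ... | no _ with () ← trans (sym (cong does eq)) (trans (sym (lookup∘tabulate (does ∘ P?) x)) ([]=⇒lookup x∈))

module _ {P : Pred (Subset n) ℓ} (P? : Decidable P) (f : Subset n → ℕ) where

  private
    argmin-below : ∀ k D → P D → f D ≤ k → ∃ λ D → P D × ∀ D′ → P D′ → f D ≤ f D′
    argmin-below 0       D pD fD≤0 = D , pD , λ _ _ → ≤-trans fD≤0 z≤n
    argmin-below (suc k) D pD fD≤k+1 with anySubset? (λ D′ → P? D′ ×-dec (f D′ ≤? k))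
    ... | yes (D′ , pD′ , fD′≤k) = argmin-below k D′ pD′ fD′≤k
    ... | no ∄smaller = D , pD , λ D′ pD′ → ≤-trans fD≤k+1 (≰⇒> λ fD′≤k → ∄smaller (D′ , pD′ , fD′≤k))

  argmin : ∃ P → ∃ λ D → P D × ∀ D′ → P D′ → f D ≤ f D′
  argmin (D , pD) = argmin-below (f D) D pD ≤-refl

module _ (G : Graph n) where

  infix 4 _~_
  _~_ : Fin n → Fin n → Set
  u ~ v = T (adj G u v)

  ~-sym : ∀ {u v} → u ~ v → v ~ u
  ~-sym {u} {v} = subst T (Graph.sym G u v)

  ~-irrefl : ∀ {u v} → u ~ v → u ≢ v
  ~-irrefl {u} u~u refl = subst T (irrefl G u) u~u

  T-outside-neighbour : ∀ {D v x} → v ~ x → x ∉ D → T (adj G v x ∧ not (lookup D x))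
  T-outside-neighbour v~x x∉D =
    Equivalence.from T-∧ (v~x , Equivalence.from T-not-≡ (lookup-∉ x∉D))

  dominating? : Decidable (Dominating G)
  dominating? D = all? λ v → ¬? (v ∈? D) →-dec any? λ u → u ∈? D ×-dec T? (adj G u v)

  ⊤-dominating : Dominating G ⊤
  ⊤-dominating v v∉⊤ = contradiction ∈⊤ v∉⊤

  PrivateNeighbour : Subset n → Fin n → Fin n → Set
  PrivateNeighbour D v x = x ∉ D × v ~ x × ¬ (∃ λ y → y ∈ D × y ≢ v × y ~ x)

  private-neighbour? : ∀ D v → Decidable (PrivateNeighbour D v)
  private-neighbour? D v x =
    ¬? (x ∈? D) ×-dec T? (adj G v x) ×-dec ¬? (any? λ y → y ∈? D ×-dec ¬? (y ≟ v) ×-dec T? (adj G y x))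

  InnerVertex : Subset n → Fin n → Set
  InnerVertex D v = v ∈ D × ∃ λ z → z ∈ D × v ~ z

  inner-vertex? : ∀ D → Decidable (InnerVertex D)
  inner-vertex? D v = v ∈? D ×-dec any? λ z → z ∈? D ×-dec T? (adj G v z)

  inner : Subset n → Subset n
  inner D = select (inner-vertex? D)

  dominating-exchange : ∀ {D D′ v w} → Dominating G D → D - v ⊆ D′ → w ∈ D′ → w ~ v →
    (∀ {x} → x ∉ D → v ~ x → x ∉ D′ → ∃ λ y → y ∈ D′ × y ~ x) → Dominating G D′
  dominating-exchange {v = v} {w} D-dom D-v⊆D′ w∈D′ w~v redominate x x∉D′ with x ≟ v
  ... | yes refl = w , w∈D′ , w~v
  ... | no x≢v with D-dom x (p-v⊆q∧x∉q∧x≢v⇒x∉p D-v⊆D′ x∉D′ x≢v)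
  ...   | y , y∈D , y~x with y ≟ v
  ...     | yes refl = redominate (p-v⊆q∧x∉q∧x≢v⇒x∉p D-v⊆D′ x∉D′ x≢v) y~x x∉D′
  ...     | no y≢v   = y , D-v⊆D′ (x∈p∧x≢y⇒x∈p-y y∈D y≢v) , y~x

  remove-dominating : ∀ {D v w} → Dominating G D → w ∈ D → w ~ v →
    (∀ x → ¬ PrivateNeighbour D v x) → Dominating G (D - v)
  remove-dominating {D} {v} D-dom w∈D w~v no-private =
    dominating-exchange D-dom (λ x∈ → x∈) (x∈p∧x≢y⇒x∈p-y w∈D (~-irrefl w~v)) w~v redominate
    where
    redominate : ∀ {x} → x ∉ D → v ~ x → x ∉ D - v → ∃ λ y → y ∈ D - v × y ~ x
    redominate {x} x∉D v~x _ with any? (λ y → y ∈? D ×-dec ¬? (y ≟ v) ×-dec T? (adj G y x))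
    ... | yes (y , y∈D , y≢v , y~x) = y , x∈p∧x≢y⇒x∈p-y y∈D y≢v , y~x
    ... | no ∄other = contradiction (x∉D , v~x , ∄other) (no-private x)

  exchange-dominating : ∀ {D v w u} → Dominating G D → w ∈ D → w ~ v →
    (∀ {x} → x ∉ D → v ~ x → x ≡ u) → Dominating G (⁅ u ⁆ ∪ (D - v))
  exchange-dominating {u = u} D-dom w∈D w~v only-u =
    dominating-exchange D-dom (λ x∈ → x∈p∪q⁺ (inj₂ x∈))
      (x∈p∪q⁺ (inj₂ (x∈p∧x≢y⇒x∈p-y w∈D (~-irrefl w~v)))) w~v
      λ x∉D v~x x∉D′ → contradiction (x∈p∪q⁺ (inj₁ (subst (_∈ ⁅ u ⁆) (sym (only-u x∉D v~x)) (x∈⁅x⁆ u)))) x∉D′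

  inner-exchange-⊂ : ∀ {D v w u} → v ∈ D → w ∈ D → w ~ v → PrivateNeighbour D v u →
    inner (⁅ u ⁆ ∪ (D - v)) ⊂ inner D
  inner-exchange-⊂ {D} {v} {w} {u} v∈D w∈D w~v (u∉D , _ , ∄other) = inner′⊆inner , v , v∈inner , v∉inner′
    where
    member : ∀ {y} → y ∈ ⁅ u ⁆ ∪ (D - v) → y ≡ u ⊎ (y ∈ D × y ≢ v)
    member {y} y∈ with x∈p∪q⁻ ⁅ u ⁆ (D - v) y∈
    ... | inj₁ y∈⁅u⁆  = inj₁ (x∈⁅y⁆⇒x≡y u y∈⁅u⁆)
    ... | inj₂ y∈D-v = inj₂ (x∈p-y⁻ D y∈D-v)
    inner′⊆inner : inner (⁅ u ⁆ ∪ (D - v)) ⊆ inner D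
    inner′⊆inner y∈ with ∈-select⁻ (inner-vertex? _) y∈
    ... | y∈D′ , z , z∈D′ , y~z with member y∈D′ | member z∈D′
    ... | inj₁ refl         | inj₁ refl         = contradiction refl (~-irrefl y~z)
    ... | inj₁ refl         | inj₂ (z∈D , z≢v) = contradiction (z , z∈D , z≢v , ~-sym y~z) ∄other
    ... | inj₂ (y∈D , y≢v) | inj₁ refl         = contradiction (_ , y∈D , y≢v , y~z) ∄other
    ... | inj₂ (y∈D , _)   | inj₂ (z∈D , _)   = ∈-select⁺ (inner-vertex? D) (y∈D , z , z∈D , y~z)
    v∈inner : v ∈ inner D
    v∈inner = ∈-select⁺ (inner-vertex? D) (v∈D , w , w∈D , ~-sym w~v)
    v∉inner′ : v ∉ inner (⁅ u ⁆ ∪ (D - v))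
    v∉inner′ v∈ with member (proj₁ (∈-select⁻ (inner-vertex? _) v∈))
    ... | inj₁ refl      = u∉D v∈D
    ... | inj₂ (_ , v≢v) = v≢v refl

  module _ (δ≥2 : MinDegreeAtLeast G 2) {D : Subset n} (D-dom : Dominating G D)
           (γ-minimal : ∀ D′ → Dominating G D′ → ∣ D ∣ ≤ ∣ D′ ∣)
           (inner-minimal : ∀ D′ → Dominating G D′ → ∣ D′ ∣ ≤ ∣ D ∣ → ∣ inner D ∣ ≤ ∣ inner D′ ∣)
           where

    module _ {v} (v∈D : v ∈ D) (outNbrs<2 : outNbrs G D v < 2) where

      outside-unique : ∀ {x y} → x ∉ D → v ~ x → y ∉ D → v ~ y → x ≡ y
      outside-unique x∉D v~x y∉D v~y =
        countV<2⇒≡ _ outNbrs<2 (T-outside-neighbour v~x x∉D) (T-outside-neighbour v~y y∉D)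

      neighbour-in-D : ∃ λ w → w ∈ D × w ~ v
      neighbour-in-D with 2≤countV⇒distinct (adj G v) (δ≥2 v)
      ... | a , b , v~a , v~b , a≢b with a ∈? D | b ∈? D
      ...   | yes a∈D | _       = a , a∈D , ~-sym v~a
      ...   | no _    | yes b∈D = b , b∈D , ~-sym v~b
      ...   | no a∉D  | no b∉D  = contradiction (outside-unique a∉D v~a b∉D v~b) a≢b

      outNbrs<2⇒⊥ : ⊥
      outNbrs<2⇒⊥ with neighbour-in-D | any? (private-neighbour? D v)
      ... | w , w∈D , w~v | yes (u , u-private@(u∉D , v~u , _)) =
        <⇒≱ (p⊂q⇒∣p∣<∣q∣ (inner-exchange-⊂ v∈D w∈D w~v u-private))
            (inner-minimal _ (exchange-dominating D-dom w∈D w~v λ x∉D v~x → outside-unique x∉D v~x u∉D v~u)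
                           (∣⁅u⁆∪p-v∣≤∣p∣ u v∈D))
      ... | w , w∈D , w~v | no ∄private =
        <⇒≱ (x∈p⇒∣p-x∣<∣p∣ v∈D) (γ-minimal _ (remove-dominating D-dom w∈D w~v λ x px → ∄private (x , px)))

    2≤outNbrs : ∀ {v} → v ∈ D → 2 ≤ outNbrs G D v
    2≤outNbrs v∈D = ≮⇒≥ (outNbrs<2⇒⊥ v∈D)

  γ-set-with-2≤outNbrs : MinDegreeAtLeast G 2 →
    ∃ λ D → IsGammaSet G D × (∀ v → v ∈ D → 2 ≤ outNbrs G D v)
  γ-set-with-2≤outNbrs δ≥2
    with D₀ , D₀-dom , D₀-min ← argmin dominating? ∣_∣ (⊤ , ⊤-dominating)
    with D , (D-dom , ∣D∣≤∣D₀∣) , D-min ← argmin (λ D → dominating? D ×-dec ∣ D ∣ ≤? ∣ D₀ ∣) (∣_∣ ∘ inner)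
                                                  (D₀ , D₀-dom , ≤-refl)
    = D , (D-dom , γ-minimal) ,
      λ _ → 2≤outNbrs δ≥2 D-dom γ-minimal λ D′ D′-dom ∣D′∣≤∣D∣ → D-min D′ (D′-dom , ≤-trans ∣D′∣≤∣D∣ ∣D∣≤∣D₀∣)
    where
    γ-minimal : ∀ D′ → Dominating G D′ → ∣ D ∣ ≤ ∣ D′ ∣
    γ-minimal D′ D′-dom = ≤-trans ∣D∣≤∣D₀∣ (D₀-min D′ D′-dom)

  certified-γ-set⇒γ≡γcer : ∀ {D k k′} → IsGammaSet G D → Certified G D → IsGamma G k → IsGammaCer G k′ → k ≡ k′
  certified-γ-set⇒γ≡γcer (_ , D-min) D-cer ((Dk , Dk-dom , refl) , k-min) ((Dc , (Dc-dom , _) , refl) , k′-min) =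
    ≤-antisym (k-min Dc Dc-dom) (≤-trans (k′-min _ D-cer) (D-min Dk Dk-dom))

corollary2p3 : {n : ℕ} (G : Graph n) → MinDegreeAtLeast G 2 →
    (∃ λ D → IsGammaSet G D × (∀ v → v ∈ D → 2 ≤ outNbrs G D v))
    × (∀ k k′ → IsGamma G k → IsGammaCer G k′ → k ≡ k′)
corollary2p3 G δ≥2 with D , γ-set , 2≤out ← γ-set-with-2≤outNbrs G δ≥2 =
  (D , γ-set , 2≤out) ,
  λ _ _ → certified-γ-set⇒γ≡γcer G γ-set (proj₁ γ-set , λ v v∈D → inj₂ (2≤out v v∈D))
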